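{- Let $m\ge 4$, $X=\mathbb{F}_{2^m}\setminus\{0,1\}$, and let $W_4$ be as in the context. Then every element $x\in X$ lies in exactly $r_4=\frac{(2^m-4)(2^m-8)}{3!}$ blocks of $W_4$ (the repetition number of $(X,W_2,W_4)$), and $|W_4|=\frac{(2^m-2)(2^m-4)(2^m-8)}{4!}$.
   Context: $\mathbb{F}_{2^m}$ is the finite field with $2^m$ elements, with zero $0$ and unity $1$; all sums are in $\mathbb{F}_{2^m}$. For each integer $k\ge 2$, $W_k=\{B\subset X : |B|=k,\ \sum_{i\in B} i=1,\ \text{and } \binom{B}{\ell}\cap W_\ell=\emptyset \text{ for all } 2\le \ell\le k-3\}$ (recursive definition; $\binom{B}{\ell}$ is the set of $\ell$-subsets of $B$); in particular $W_4=\{B\subset X: |B|=4,\ \sum_{i\in B}i=1\}$. -}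

module Defs where

open import Data.Nat using (ℕ; zero; suc)
open import Data.Bool using (Bool; true; false; _xor_)
import Data.Bool as Bool
open import Data.Vec using (Vec; []; _∷_; replicate; zipWith)
open import Data.Vec.Properties using (≡-dec)
open import Data.List using (List; []; _∷_; map; _++_; filter; length; foldr)
open import Data.Product using (_×_)
open import Relation.Nullary using (¬_; ¬?)
open import Relation.Nullary.Decidable using (_×-dec_)
open import Relation.Binary.Definitions using (DecidableEquality)
open import Relation.Binary.PropositionalEquality using (_≡_; _≢_)
import Data.List.Membership.DecPropositional as DecMem

-- The additive group of F_{2^m} together with its unity 1, in the polynomial
-- basis representation: an element is its coordinate vector in F_2^m w.r.t.
-- the basis 1, α, …, α^{m-1}; addition is coordinatewise XOR, 0 is the zero
-- vector, and 1 is the first basis vector.  (Only +, 0 and 1 occur in the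
-- statement.)
F : ℕ → Set
F m = Vec Bool m

_+F_ : ∀ {m} → F m → F m → F m
_+F_ = zipWith _xor_

0F : (m : ℕ) → F m
0F m = replicate m false

1F : (m : ℕ) → F m
1F zero = []
1F (suc m) = true ∷ replicate m false

_≟F_ : ∀ {m} → DecidableEquality (F m)
_≟F_ = ≡-dec Bool._≟_

elements : (m : ℕ) → List (F m)
elements zero = [] ∷ []
elements (suc m) = map (false ∷_) (elements m) ++ map (true ∷_) (elements m)

X : (m : ℕ) → List (F m)
X m = filter (λ x → ¬? (x ≟F 0F m) ×-dec ¬? (x ≟F 1F m)) (elements m)

-- all k-element sub-lists (order preserving) of a list; for a duplicate-free
-- list these are exactly its k-subsets, each listed once
combinations : ∀ {a} {A : Set a} → ℕ → List A → List (List A)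
combinations zero _ = [] ∷ []
combinations (suc k) [] = []
combinations (suc k) (x ∷ xs) = map (x ∷_) (combinations k xs) ++ combinations (suc k) xs

sumF : (m : ℕ) → List (F m) → F m
sumF m = foldr _+F_ (0F m)

W4 : (m : ℕ) → List (List (F m))
W4 m = filter (λ B → sumF m B ≟F 1F m) (combinations 4 (X m))

rep4 : (m : ℕ) → F m → ℕ
rep4 m x = length (filter (λ B → x ∈? B) (W4 m))
  where open DecMem (_≟F_ {m})

module Submission where

-- The proof is double counting.  Let r x be the number of 3-subsets R ⊆ X ∖ {x}
-- with x + ΣR = 1.  The blocks through x are exactly the sets {x} ∪ R, and
-- counting pairs (block, element) gives 4|W₄| = Σ_{x∈X} r x.  Next, 6 r x counts
-- ordered triples (a, b, c) of distinct elements of X ∖ {x} with c = x+a+b+1.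
-- For a ∈ span{x,1} there are none; for a ∉ span{x,1} the vectors a, x, 1 are
-- F_2-independent and the admissible b are exactly the n - 8 elements outside
-- their span.  As there are n - 4 such a, 6 r x = (n-4)(n-8); likewise
-- |X| = n - |span{1}| = n - 2, whence 24|W₄| = (n-2)(n-4)(n-8).

open import Defs
open import Data.Nat using (ℕ; zero; suc; _+_; _*_; _∸_; _^_; _≤_; z≤n; s≤s)
open import Data.Nat.Properties
open import Data.Bool using (Bool; true; false; _xor_; not; _∧_; if_then_else_)
import Data.Bool as Bool
open import Data.Fin using (Fin; zero; suc)
open import Data.Vec using (Vec; []; _∷_; lookup; head; tail)
import Data.Vec as Vec
open import Data.Vec.Properties using (lookup-map)
open import Data.List using (List; []; _∷_; map; _++_; filter; length)
open import Data.List.Properties using (length-++; length-map)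
open import Data.List.Relation.Unary.All using (All; []; _∷_)
import Data.List.Relation.Unary.All as All
open import Data.List.Relation.Unary.All.Properties using (map⁺; ++⁺; all-filter)
open import Data.List.Relation.Unary.Any using (here; there)
import Data.List.Membership.DecPropositional as DecMembership
open import Data.Product using (_×_; _,_; proj₁; proj₂; ∃)
open import Data.Sum using (_⊎_; inj₁; inj₂)
open import Data.Empty using (⊥-elim)
open import Relation.Nullary using (¬_; ¬?; Dec; yes; no; does)
open import Relation.Nullary.Decidable using (_×-dec_)
open import Relation.Unary using (Pred; Decidable)
open import Relation.Binary.Definitions using (DecidableEquality)
open import Relation.Binary.PropositionalEquality
open import Algebra.Properties.CommutativeSemigroup +-commutativeSemigroup
  using () renaming (interchange to +-interchange)

χ : ∀ {p} {P : Set p} → Dec P → ℕ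
χ d = if does d then 1 else 0

χ-yes : ∀ {p} {P : Set p} → P → (d : Dec P) → χ d ≡ 1
χ-yes p (yes _) = refl
χ-yes p (no ¬p) = ⊥-elim (¬p p)

χ-no : ∀ {p} {P : Set p} → ¬ P → (d : Dec P) → χ d ≡ 0
χ-no ¬p (yes p) = ⊥-elim (¬p p)
χ-no ¬p (no _) = refl

χ-⇔ : ∀ {p q} {P : Set p} {Q : Set q} → (P → Q) → (Q → P) → (d : Dec P) (e : Dec Q) → χ d ≡ χ e
χ-⇔ f g (yes p) e = sym (χ-yes (f p) e)
χ-⇔ f g (no ¬p) e = sym (χ-no (λ q → ¬p (g q)) e)

χ-× : ∀ {p q} {P : Set p} {Q : Set q} (d : Dec P) (e : Dec Q) → χ (d ×-dec e) ≡ χ d * χ e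
χ-× (yes p) (yes q) = refl
χ-× (yes p) (no q) = refl
χ-× (no p) e = refl

module _ {a} {A : Set a} where

  ∑ : List A → (A → ℕ) → ℕ
  ∑ [] f = 0
  ∑ (x ∷ xs) f = f x + ∑ xs f

  ∑-++ : ∀ xs ys f → ∑ (xs ++ ys) f ≡ ∑ xs f + ∑ ys f
  ∑-++ [] ys f = refl
  ∑-++ (x ∷ xs) ys f rewrite ∑-++ xs ys f = sym (+-assoc (f x) _ _)

  ∑-cong : ∀ xs {f g} → (∀ z → f z ≡ g z) → ∑ xs f ≡ ∑ xs g
  ∑-cong [] e = refl
  ∑-cong (x ∷ xs) e = cong₂ _+_ (e x) (∑-cong xs e)

  ∑-congᴬ : ∀ {xs f g} → All (λ z → f z ≡ g z) xs → ∑ xs f ≡ ∑ xs g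
  ∑-congᴬ [] = refl
  ∑-congᴬ (e ∷ es) = cong₂ _+_ e (∑-congᴬ es)

  ∑-+ : ∀ xs f g → ∑ xs (λ z → f z + g z) ≡ ∑ xs f + ∑ xs g
  ∑-+ [] f g = refl
  ∑-+ (x ∷ xs) f g rewrite ∑-+ xs f g = +-interchange (f x) (g x) (∑ xs f) (∑ xs g)

  ∑-*ˡ : ∀ xs c f → ∑ xs (λ z → c * f z) ≡ c * ∑ xs f
  ∑-*ˡ [] c f = sym (*-zeroʳ c)
  ∑-*ˡ (x ∷ xs) c f rewrite ∑-*ˡ xs c f = sym (*-distribˡ-+ c (f x) _)

  ∑-*ʳ : ∀ xs c f → ∑ xs (λ z → f z * c) ≡ ∑ xs f * c
  ∑-*ʳ xs c f = trans (∑-cong xs (λ z → *-comm (f z) c)) (trans (∑-*ˡ xs c f) (*-comm c _))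

  ∑-const : ∀ xs c → ∑ xs (λ _ → c) ≡ length xs * c
  ∑-const [] c = refl
  ∑-const (x ∷ xs) c rewrite ∑-const xs c = refl

  ∑-zero : ∀ xs f → (∀ z → f z ≡ 0) → ∑ xs f ≡ 0
  ∑-zero xs f e = trans (∑-cong xs e) (trans (∑-const xs 0) (*-zeroʳ (length xs)))

  ∑-filter : ∀ {p} {P : Pred A p} (P? : Decidable P) xs f → ∑ (filter P? xs) f ≡ ∑ xs (λ z → χ (P? z) * f z)
  ∑-filter P? [] f = refl
  ∑-filter P? (x ∷ xs) f with does (P? x)
  ... | true = cong₂ _+_ (sym (+-identityʳ (f x))) (∑-filter P? xs f)
  ... | false = ∑-filter P? xs f

  length-filter : ∀ {p} {P : Pred A p} (P? : Decidable P) xs → length (filter P? xs) ≡ ∑ xs (λ z → χ (P? z))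
  length-filter P? [] = refl
  length-filter P? (x ∷ xs) with does (P? x)
  ... | true = cong suc (length-filter P? xs)
  ... | false = length-filter P? xs

module _ {a b} {A : Set a} {B : Set b} where

  ∑-map : ∀ (g : A → B) xs f → ∑ (map g xs) f ≡ ∑ xs (λ z → f (g z))
  ∑-map g [] f = refl
  ∑-map g (x ∷ xs) f = cong (f (g x) +_) (∑-map g xs f)

  ∑-swap : ∀ (xs : List A) (ys : List B) (f : A → B → ℕ) → ∑ xs (λ x → ∑ ys (f x)) ≡ ∑ ys (λ y → ∑ xs (λ x → f x y))
  ∑-swap [] ys f = sym (∑-zero ys _ (λ _ → refl))
  ∑-swap (x ∷ xs) ys f = trans (cong (∑ ys (f x) +_) (∑-swap xs ys f)) (sym (∑-+ ys (f x) _))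

-- A term over k variables built from 0 and + denotes the same element of
-- F_2^m = Vec Bool m in every coordinate, namely its value in F_2 = (Bool, xor)
-- at that coordinate.  Hence an identity between two such terms holds in every
-- F_2^m as soon as it holds for all 2^k Boolean assignments, which is decidable.
-- This lets us discharge all the commutative/associative/characteristic-2
-- rearrangements below by `solve`.

data Term (k : ℕ) : Set where
  var : Fin k → Term k
  𝟎 : Term k
  _⊕_ : Term k → Term k → Term k
infixr 6 _⊕_

⟦_⟧ : ∀ {m k} → Term k → Vec (F m) k → F m
⟦ var i ⟧ ρ = lookup ρ i
⟦_⟧ {m} 𝟎 ρ = 0F m
⟦ s ⊕ t ⟧ ρ = ⟦ s ⟧ ρ +F ⟦ t ⟧ ρ

⟦_⟧₂ : ∀ {k} → Term k → Vec Bool k → Bool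
⟦ var i ⟧₂ β = lookup β i
⟦ 𝟎 ⟧₂ β = false
⟦ s ⊕ t ⟧₂ β = ⟦ s ⟧₂ β xor ⟦ t ⟧₂ β

⟦⟧-coordinatewise : ∀ {m k} (t : Term k) (ρ : Vec (F (suc m)) k) →
                    ⟦ t ⟧ ρ ≡ ⟦ t ⟧₂ (Vec.map head ρ) ∷ ⟦ t ⟧ (Vec.map tail ρ)
⟦⟧-coordinatewise (var i) ρ rewrite lookup-map i head ρ | lookup-map i tail ρ = η (lookup ρ i)
  where
  η : ∀ {m} (v : Vec Bool (suc m)) → v ≡ head v ∷ tail v
  η (_ ∷ _) = refl
⟦⟧-coordinatewise 𝟎 ρ = refl
⟦⟧-coordinatewise (s ⊕ t) ρ rewrite ⟦⟧-coordinatewise s ρ | ⟦⟧-coordinatewise t ρ = refl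

lift-identity : ∀ {k} (s t : Term k) → (∀ β → ⟦ s ⟧₂ β ≡ ⟦ t ⟧₂ β) →
                ∀ {m} (ρ : Vec (F m) k) → ⟦ s ⟧ ρ ≡ ⟦ t ⟧ ρ
lift-identity s t h {zero} ρ with ⟦ s ⟧ ρ | ⟦ t ⟧ ρ
... | [] | [] = refl
lift-identity s t h {suc m} ρ rewrite ⟦⟧-coordinatewise s ρ | ⟦⟧-coordinatewise t ρ =
  cong₂ _∷_ (h (Vec.map head ρ)) (lift-identity s t h (Vec.map tail ρ))

everywhere : ∀ k → (Vec Bool k → Bool) → Bool
everywhere zero p = p []
everywhere (suc k) p = everywhere k (λ v → p (false ∷ v)) ∧ everywhere k (λ v → p (true ∷ v))

∧≡true : ∀ {u v} → u ∧ v ≡ true → u ≡ true × v ≡ true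
∧≡true {true} e = refl , e

everywhere-sound : ∀ k p → everywhere k p ≡ true → ∀ β → p β ≡ true
everywhere-sound zero p e [] = e
everywhere-sound (suc k) p e (false ∷ β) = everywhere-sound k _ (proj₁ (∧≡true e)) β
everywhere-sound (suc k) p e (true ∷ β) =
  everywhere-sound k _ (proj₂ (∧≡true {everywhere k (λ v → p (false ∷ v))} e)) β

-- The decision procedure: `solve s t refl ρ` proves ⟦ s ⟧ ρ ≡ ⟦ t ⟧ ρ whenever
-- s = t is an identity of F_2 (the `refl` is the finite check).
solve : ∀ {k} (s t : Term k) → everywhere k (λ β → not (⟦ s ⟧₂ β xor ⟦ t ⟧₂ β)) ≡ true →
        ∀ {m} (ρ : Vec (F m) k) → ⟦ s ⟧ ρ ≡ ⟦ t ⟧ ρ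
solve {k} s t check = lift-identity s t (λ β → xnor (everywhere-sound k _ check β))
  where
  xnor : ∀ {u v} → not (u xor v) ≡ true → u ≡ v
  xnor {false} {false} _ = refl
  xnor {true} {true} _ = refl

v₀ : ∀ {k} → Term (suc k)
v₀ = var zero
v₁ : ∀ {k} → Term (suc (suc k))
v₁ = var (suc zero)
v₂ : ∀ {k} → Term (suc (suc (suc k)))
v₂ = var (suc (suc zero))
v₃ : ∀ {k} → Term (suc (suc (suc (suc k))))
v₃ = var (suc (suc (suc zero)))
v₄ : ∀ {k} → Term (suc (suc (suc (suc (suc k)))))
v₄ = var (suc (suc (suc (suc zero))))

+F-identityˡ : ∀ {m} (x : F m) → 0F m +F x ≡ x
+F-identityˡ x = solve (𝟎 ⊕ v₀) v₀ refl (x ∷ [])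

≡⇒+F≡0 : ∀ {m} {u v : F m} → u ≡ v → u +F v ≡ 0F m
≡⇒+F≡0 {u = u} refl = solve (v₀ ⊕ v₀) 𝟎 refl (u ∷ [])

+F≡0⇒≡ : ∀ {m} {u v : F m} → u +F v ≡ 0F m → u ≡ v
+F≡0⇒≡ {m} {u} {v} e = begin
    u              ≡⟨ solve v₀ ((v₀ ⊕ v₁) ⊕ v₁) refl (u ∷ v ∷ []) ⟩
    (u +F v) +F v  ≡⟨ cong (_+F v) e ⟩
    0F m +F v      ≡⟨ +F-identityˡ v ⟩
    v              ∎
  where open ≡-Reasoning

+F-transfer : ∀ {m} {u v u' v' : F m} → u +F v ≡ u' +F v' → u ≡ v → u' ≡ v'
+F-transfer e u≡v = +F≡0⇒≡ (trans (sym e) (≡⇒+F≡0 u≡v))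

module Multiplicity {A : Set} (_≟_ : DecidableEquality A) where

  count : A → List A → ℕ
  count t L = ∑ L (λ c → χ (t ≟ c))

  remove : A → List A → List A
  remove y L = filter (λ z → ¬? (y ≟ z)) L

  Distinct : List A → Set
  Distinct L = ∀ t → count t L ≤ 1

  χ-sym : ∀ u v → χ (u ≟ v) ≡ χ (v ≟ u)
  χ-sym u v = χ-⇔ sym sym (u ≟ v) (v ≟ u)

  χ-refl : ∀ u → χ (u ≟ u) ≡ 1
  χ-refl u = χ-yes refl (u ≟ u)

  count-filter : ∀ {p} {P : A → Set p} (P? : ∀ z → Dec (P z)) t L → count t (filter P? L) ≡ χ (P? t) * count t L
  count-filter P? t L = trans (∑-filter P? L _) (trans (∑-cong L same-weight) (∑-*ˡ L (χ (P? t)) _))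
    where
    same-weight : ∀ z → χ (P? z) * χ (t ≟ z) ≡ χ (P? t) * χ (t ≟ z)
    same-weight z with t ≟ z
    ... | yes refl = refl
    ... | no _ = trans (*-zeroʳ (χ (P? z))) (sym (*-zeroʳ (χ (P? t))))

  count-filter≤ : ∀ {p} {P : A → Set p} (P? : ∀ z → Dec (P z)) t L → count t (filter P? L) ≤ count t L
  count-filter≤ P? t L rewrite count-filter P? t L with does (P? t)
  ... | true = ≤-reflexive (+-identityʳ (count t L))
  ... | false = z≤n

  count-remove : ∀ y t L → count t (remove y L) ≡ χ (¬? (y ≟ t)) * count t L
  count-remove y = count-filter (λ z → ¬? (y ≟ z))

  distinct-filter : ∀ {p} {P : A → Set p} (P? : ∀ z → Dec (P z)) L → Distinct L → Distinct (filter P? L)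
  distinct-filter P? L d t = ≤-trans (count-filter≤ P? t L) (d t)

  distinct-tail : ∀ x L → Distinct (x ∷ L) → Distinct L
  distinct-tail x L d t = ≤-trans (m≤n+m (count t L) (χ (t ≟ x))) (d t)

  distinct-head : ∀ x L → Distinct (x ∷ L) → count x L ≡ 0
  distinct-head x L d with d x
  ... | x-once rewrite χ-refl x = n≤0⇒n≡0 (≤-pred x-once)

  remove-absent : ∀ y L → count y L ≡ 0 → remove y L ≡ L
  remove-absent y [] e = refl
  remove-absent y (x ∷ L) e with y ≟ x
  ... | yes _ = ⊥-elim (1+n≢0 e)
  ... | no _ = cong (x ∷_) (remove-absent y L e)

  absent⇒All≢ : ∀ y L → count y L ≡ 0 → All (λ z → ¬ y ≡ z) L
  absent⇒All≢ y [] e = []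
  absent⇒All≢ y (x ∷ L) e with y ≟ x
  ... | yes _ = ⊥-elim (1+n≢0 e)
  ... | no y≢x = y≢x ∷ absent⇒All≢ y L e

  open DecMembership _≟_ using (_∈?_)

  χ-∈≡count : ∀ x B → Distinct B → χ (x ∈? B) ≡ count x B
  χ-∈≡count x [] d = χ-no (λ ()) (x ∈? [])
  χ-∈≡count x (b ∷ B) d = split (x ≟ b)
    where
    split : (x≟b : Dec (x ≡ b)) → χ (x ∈? (b ∷ B)) ≡ χ x≟b + count x B
    split (yes refl) = trans (χ-yes (here refl) (x ∈? (x ∷ B))) (cong suc (sym (distinct-head x B d)))
    split (no x≢b) = trans (χ-⇔ (λ { (here e) → ⊥-elim (x≢b e) ; (there p) → p }) there (x ∈? (b ∷ B)) (x ∈? B))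
                           (χ-∈≡count x B (distinct-tail b B d))

  ∑-select : ∀ x L (f : A → ℕ) → ∑ L (λ y → f y * χ (x ≟ y)) ≡ f x * count x L
  ∑-select x L f = trans (∑-cong L at-x) (∑-*ˡ L (f x) _)
    where
    at-x : ∀ y → f y * χ (x ≟ y) ≡ f x * χ (x ≟ y)
    at-x y with x ≟ y
    ... | yes refl = refl
    ... | no _ = trans (*-zeroʳ (f y)) (sym (*-zeroʳ (f x)))

  -- Sum over the ways of singling out one entry y of B, f applied to y and the
  -- list of the other entries.
  pointed : (A → List A → ℕ) → List A → ℕ
  pointed f [] = 0
  pointed f (x ∷ xs) = f x xs + pointed (λ y R → f y (x ∷ R)) xs

  pointed-cong : ∀ {f g} → (∀ y R → f y R ≡ g y R) → ∀ B → pointed f B ≡ pointed g B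
  pointed-cong e [] = refl
  pointed-cong e (x ∷ B) = cong₂ _+_ (e x B) (pointed-cong (λ y R → e y (x ∷ R)) B)

  combinations-inside : ∀ k L → All (λ B → length B ≡ k × (∀ t → count t B ≤ count t L)) (combinations k L)
  combinations-inside zero L = (refl , λ t → z≤n) ∷ []
  combinations-inside (suc k) [] = []
  combinations-inside (suc k) (x ∷ xs) =
    ++⁺ (map⁺ (All.map (λ { (len , sub) → cong suc len , λ t → +-monoʳ-≤ (χ (t ≟ x)) (sub t) }) (combinations-inside k xs)))
        (All.map (λ { (len , sub) → len , λ t → ≤-trans (sub t) (m≤n+m _ (χ (t ≟ x))) }) (combinations-inside (suc k) xs))

  combinations-distinct : ∀ k L → Distinct L → All Distinct (combinations k L)
  combinations-distinct k L d = All.map (λ { (_ , sub) t → ≤-trans (sub t) (d t) }) (combinations-inside k L)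

  -- Double counting: a (k+1)-subset of L with a distinguished element y is the
  -- same thing as an element y of L together with a k-subset of L ∖ {y}.
  ∑-pointed-combinations : ∀ L → Distinct L → ∀ k f →
    ∑ (combinations (suc k) L) (pointed f) ≡ ∑ L (λ y → ∑ (combinations k (remove y L)) (f y))
  ∑-pointed-combinations [] d k f = refl
  ∑-pointed-combinations (x ∷ xs) d k f =
    begin
      ∑ (map (x ∷_) (combinations k xs) ++ combinations (suc k) xs) (pointed f)
    ≡⟨ ∑-++ (map (x ∷_) (combinations k xs)) _ _ ⟩
      ∑ (map (x ∷_) (combinations k xs)) (pointed f) + ∑ (combinations (suc k) xs) (pointed f)
    ≡⟨ cong₂ _+_ (trans (∑-map (x ∷_) (combinations k xs) (pointed f)) (∑-+ (combinations k xs) (f x) (pointed f')))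
                 (∑-pointed-combinations xs d-xs k f) ⟩
      (∑ (combinations k xs) (f x) + ∑ (combinations k xs) (pointed f')) + ∑ xs (λ y → ∑ (combinations k (remove y xs)) (f y))
    ≡⟨ +-assoc (∑ (combinations k xs) (f x)) _ _ ⟩
      ∑ (combinations k xs) (f x) + (∑ (combinations k xs) (pointed f') + ∑ xs (λ y → ∑ (combinations k (remove y xs)) (f y)))
    ≡⟨ cong₂ _+_ (cong (λ L → ∑ (combinations k L) (f x)) (sym remove-x))
                 (trans (others-chosen k) (∑-congᴬ (All.map (λ {y} x≢y → cong (λ L → ∑ (combinations k L) (f y))
                                                                             (sym (remove-y y x≢y)))
                                                            (absent⇒All≢ x xs x-fresh)))) ⟩
      ∑ (combinations k (remove x (x ∷ xs))) (f x) + ∑ xs (λ y → ∑ (combinations k (remove y (x ∷ xs))) (f y))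
    ∎
    where
    open ≡-Reasoning
    f' : A → List A → ℕ
    f' y R = f y (x ∷ R)
    d-xs = distinct-tail x xs d
    x-fresh = distinct-head x xs d
    remove-x : remove x (x ∷ xs) ≡ xs
    remove-x with x ≟ x
    ... | yes _ = remove-absent x xs x-fresh
    ... | no x≢x = ⊥-elim (x≢x refl)
    remove-y : ∀ y → ¬ x ≡ y → remove y (x ∷ xs) ≡ x ∷ remove y xs
    remove-y y x≢y with y ≟ x
    ... | yes e = ⊥-elim (x≢y (sym e))
    ... | no _ = refl
    -- for y ≠ x, the k-subsets of (x ∷ remove y xs) are those containing x
    -- (the first sum) and those avoiding it
    others-chosen : ∀ k → ∑ (combinations k xs) (pointed f') + ∑ xs (λ y → ∑ (combinations k (remove y xs)) (f y))
                        ≡ ∑ xs (λ y → ∑ (combinations k (x ∷ remove y xs)) (f y))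
    others-chosen zero = refl
    others-chosen (suc k') =
      trans (cong (_+ _) (∑-pointed-combinations xs d-xs k' f'))
      (trans (sym (∑-+ xs _ _))
      (∑-cong xs (λ y → sym (trans (∑-++ (map (x ∷_) (combinations k' (remove y xs))) _ _)
         (cong (_+ _) (∑-map (x ∷_) (combinations k' (remove y xs)) (f y)))))))

  ∑-singletons : ∀ (L : List A) (h : List A → ℕ) → ∑ (combinations 1 L) h ≡ ∑ L (λ c → h (c ∷ []))
  ∑-singletons [] h = refl
  ∑-singletons (x ∷ L) h = cong (h (x ∷ []) +_) (∑-singletons L h)

module _ {m : ℕ} where
  open Multiplicity (_≟F_ {m}) public

χ-∷ : ∀ {m} (b b' : Bool) (t c : F m) → χ ((b ∷ t) ≟F (b' ∷ c)) ≡ χ (b Bool.≟ b') * χ (t ≟F c)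
χ-∷ b b' t c = split (b Bool.≟ b') (t ≟F c)
  where
  split : (d : Dec (b ≡ b')) (e : Dec (t ≡ c)) → χ ((b ∷ t) ≟F (b' ∷ c)) ≡ χ d * χ e
  split (yes refl) (yes refl) = χ-yes refl ((b ∷ t) ≟F (b ∷ t))
  split (yes refl) (no t≢c) = χ-no (λ e → t≢c (cong tail e)) ((b ∷ t) ≟F (b ∷ c))
  split (no b≢b') e = χ-no (λ e → b≢b' (cong head e)) ((b ∷ t) ≟F (b' ∷ c))

count-elements : ∀ m (t : F m) → count t (elements m) ≡ 1
count-elements zero [] = refl
count-elements (suc m) (b ∷ t) = begin
    count (b ∷ t) (map (false ∷_) E ++ map (true ∷_) E)
  ≡⟨ ∑-++ (map (false ∷_) E) _ _ ⟩
    count (b ∷ t) (map (false ∷_) E) + count (b ∷ t) (map (true ∷_) E)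
  ≡⟨ cong₂ _+_ (half false) (half true) ⟩
    χ (b Bool.≟ false) * count t E + χ (b Bool.≟ true) * count t E
  ≡⟨ cong₂ (λ u v → χ (b Bool.≟ false) * u + χ (b Bool.≟ true) * v) (count-elements m t) (count-elements m t) ⟩
    χ (b Bool.≟ false) * 1 + χ (b Bool.≟ true) * 1
  ≡⟨ exactly-one b ⟩
    1
  ∎
  where
  open ≡-Reasoning
  E = elements m
  half : ∀ b' → count (b ∷ t) (map (b' ∷_) E) ≡ χ (b Bool.≟ b') * count t E
  half b' = trans (∑-map (b' ∷_) E _) (trans (∑-cong E (χ-∷ b b' t)) (∑-*ˡ E (χ (b Bool.≟ b')) _))
  exactly-one : ∀ b → χ (b Bool.≟ false) * 1 + χ (b Bool.≟ true) * 1 ≡ 1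
  exactly-one false = refl
  exactly-one true = refl

distinct-elements : ∀ m → Distinct (elements m)
distinct-elements m t = ≤-reflexive (count-elements m t)

length-elements : ∀ m → length (elements m) ≡ 2 ^ m
length-elements zero = refl
length-elements (suc m) = begin
    length (map (false ∷_) E ++ map (true ∷_) E)
  ≡⟨ length-++ (map (false ∷_) E) ⟩
    length (map (false ∷_) E) + length (map (true ∷_) E)
  ≡⟨ cong₂ _+_ (trans (length-map (false ∷_) E) (length-elements m)) (trans (length-map (true ∷_) E) (length-elements m)) ⟩
    2 ^ m + 2 ^ m
  ≡⟨ cong (2 ^ m +_) (sym (+-identityʳ (2 ^ m))) ⟩
    2 ^ suc m
  ∎
  where
  open ≡-Reasoning
  E = elements m

∑-count : ∀ {m} (L : List (F m)) → ∑ (elements m) (λ b → count b L) ≡ length L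
∑-count {m} L = begin
    ∑ (elements m) (λ b → ∑ L (λ d → χ (b ≟F d)))
  ≡⟨ ∑-swap (elements m) L _ ⟩
    ∑ L (λ d → ∑ (elements m) (λ b → χ (b ≟F d)))
  ≡⟨ ∑-cong L (λ d → trans (∑-cong (elements m) (λ b → χ-sym b d)) (count-elements m d)) ⟩
    ∑ L (λ _ → 1)
  ≡⟨ trans (∑-const L 1) (*-identityʳ _) ⟩
    length L
  ∎
  where open ≡-Reasoning

scale : ∀ {m} → Bool → F m → F m
scale true v = v
scale {m} false v = 0F m

combo : ∀ {m k} → Vec Bool k → Vec (F m) k → F m
combo {m} [] [] = 0F m
combo (e ∷ w) (v ∷ ρ) = scale e v +F combo w ρ

-- The same combinations as terms; for a concrete coefficient vector w,
-- ⟦ comboᵗ w ts ⟧ ρ reduces to combo w applied to the values of ts.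
scaleᵗ : ∀ {k} → Bool → Term k → Term k
scaleᵗ true t = t
scaleᵗ false t = 𝟎

comboᵗ : ∀ {j k} → Vec Bool j → Vec (Term k) j → Term k
comboᵗ [] [] = 𝟎
comboᵗ (e ∷ w) (t ∷ ts) = scaleᵗ e t ⊕ comboᵗ w ts

scale-+ : ∀ {m} e e' (v : F m) → scale e v +F scale e' v ≡ scale (e xor e') v
scale-+ false false v = solve (𝟎 ⊕ 𝟎) 𝟎 refl (v ∷ [])
scale-+ false true v = solve (𝟎 ⊕ v₀) v₀ refl (v ∷ [])
scale-+ true false v = solve (v₀ ⊕ 𝟎) v₀ refl (v ∷ [])
scale-+ true true v = solve (v₀ ⊕ v₀) 𝟎 refl (v ∷ [])

combo-+ : ∀ {m k} (w w' : F k) (ρ : Vec (F m) k) → combo w ρ +F combo w' ρ ≡ combo (w +F w') ρ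
combo-+ {m} [] [] [] = solve (𝟎 ⊕ 𝟎) 𝟎 refl ([] {A = F m})
combo-+ (e ∷ w) (e' ∷ w') (v ∷ ρ) = begin
    (scale e v +F combo w ρ) +F (scale e' v +F combo w' ρ)
  ≡⟨ solve ((v₀ ⊕ v₁) ⊕ (v₂ ⊕ v₃)) ((v₀ ⊕ v₂) ⊕ (v₁ ⊕ v₃)) refl
           (scale e v ∷ combo w ρ ∷ scale e' v ∷ combo w' ρ ∷ []) ⟩
    (scale e v +F scale e' v) +F (combo w ρ +F combo w' ρ)
  ≡⟨ cong₂ _+F_ (scale-+ e e' v) (combo-+ w w' ρ) ⟩
    scale (e xor e') v +F combo (w +F w') ρ
  ∎
  where open ≡-Reasoning

Independent : ∀ {m k} → Vec (F m) k → Set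
Independent {m} {k} ρ = ∀ w → combo w ρ ≡ 0F m → w ≡ 0F k

combo-injective : ∀ {m k} (ρ : Vec (F m) k) → Independent ρ → ∀ w w' → combo w ρ ≡ combo w' ρ → w ≡ w'
combo-injective ρ indep w w' e = +F≡0⇒≡ (indep (w +F w') (trans (sym (combo-+ w w' ρ)) (≡⇒+F≡0 e)))

span : ∀ {m k} → Vec (F m) k → List (F m)
span {k = k} ρ = map (λ w → combo w ρ) (elements k)

length-span : ∀ {m k} (ρ : Vec (F m) k) → length (span ρ) ≡ 2 ^ k
length-span {k = k} ρ = trans (length-map (λ w → combo w ρ) (elements k)) (length-elements k)

count-span-combo : ∀ {m k} (ρ : Vec (F m) k) → Independent ρ → ∀ w → count (combo w ρ) (span ρ) ≡ 1
count-span-combo {k = k} ρ indep w = begin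
    ∑ (map (λ w' → combo w' ρ) (elements k)) (λ c → χ (combo w ρ ≟F c))
  ≡⟨ ∑-map (λ w' → combo w' ρ) (elements k) _ ⟩
    ∑ (elements k) (λ w' → χ (combo w ρ ≟F combo w' ρ))
  ≡⟨ ∑-cong (elements k) (λ w' → χ-⇔ (combo-injective ρ indep w w') (cong (λ u → combo u ρ))
                                       (combo w ρ ≟F combo w' ρ) (w ≟F w')) ⟩
    count w (elements k)
  ≡⟨ count-elements k w ⟩
    1
  ∎
  where open ≡-Reasoning

count-span-outside : ∀ {m k} (ρ : Vec (F m) k) b → (∀ w → ¬ b ≡ combo w ρ) → count b (span ρ) ≡ 0
count-span-outside {k = k} ρ b outside =
  trans (∑-map (λ w → combo w ρ) (elements k) _) (∑-zero (elements k) _ (λ w → χ-no (outside w) (b ≟F combo w ρ)))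

independent-[] : ∀ {m} → Independent {m} []
independent-[] [] _ = refl

independent-∷ : ∀ {m k} (a : F m) (ρ : Vec (F m) k) → Independent ρ → (∀ w → ¬ a ≡ combo w ρ) → Independent (a ∷ ρ)
independent-∷ a ρ indep a∉span (true ∷ w) e = ⊥-elim (a∉span w (+F≡0⇒≡ e))
independent-∷ a ρ indep a∉span (false ∷ w) e = cong (false ∷_) (indep w (trans (sym (+F-identityˡ (combo w ρ))) e))

search : ∀ k (P : Vec Bool k → Set) → (∀ w → Dec (P w)) → (∃ λ w → P w) ⊎ (∀ w → ¬ P w)
search zero P P? with P? []
... | yes p = inj₁ ([] , p)
... | no ¬p = inj₂ (λ { [] → ¬p })
search (suc k) P P? with search k (λ w → P (false ∷ w)) (λ w → P? (false ∷ w))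
... | inj₁ (w , p) = inj₁ (false ∷ w , p)
... | inj₂ none-false with search k (λ w → P (true ∷ w)) (λ w → P? (true ∷ w))
...   | inj₁ (w , p) = inj₁ (true ∷ w , p)
...   | inj₂ none-true = inj₂ λ { (false ∷ w) → none-false w ; (true ∷ w) → none-true w }

-- Main counting principle: if f vanishes on the span of k independent vectors
-- and takes the constant value c off it, then Σ_{b ∈ F_2^m} f b = c (2^m - 2^k),
-- in the subtraction-free form below.
∑-off-span : ∀ {m k} (ρ : Vec (F m) k) → Independent ρ → (f : F m → ℕ) (c : ℕ) →
             (∀ w → f (combo w ρ) ≡ 0) → (∀ b → (∀ w → ¬ b ≡ combo w ρ) → f b ≡ c) →
             ∑ (elements m) f + c * 2 ^ k ≡ c * 2 ^ m
∑-off-span {m} {k} ρ indep f c on-span off-span = begin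
    ∑ E f + c * 2 ^ k
  ≡⟨ cong (λ l → ∑ E f + c * l) (sym (trans (∑-count (span ρ)) (length-span ρ))) ⟩
    ∑ E f + c * ∑ E (λ b → count b (span ρ))
  ≡⟨ cong (∑ E f +_) (sym (∑-*ˡ E c _)) ⟩
    ∑ E f + ∑ E (λ b → c * count b (span ρ))
  ≡⟨ sym (∑-+ E f _) ⟩
    ∑ E (λ b → f b + c * count b (span ρ))
  ≡⟨ ∑-cong E pointwise ⟩
    ∑ E (λ _ → c)
  ≡⟨ ∑-const E c ⟩
    length E * c
  ≡⟨ cong (_* c) (length-elements m) ⟩
    2 ^ m * c
  ≡⟨ *-comm (2 ^ m) c ⟩
    c * 2 ^ m
  ∎
  where
  open ≡-Reasoning
  E = elements m
  pointwise : ∀ b → f b + c * count b (span ρ) ≡ c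
  pointwise b with search k (λ w → b ≡ combo w ρ) (λ w → b ≟F combo w ρ)
  ... | inj₁ (w , refl) = begin
      f (combo w ρ) + c * count (combo w ρ) (span ρ)  ≡⟨ cong₂ (λ u v → u + c * v) (on-span w) (count-span-combo ρ indep w) ⟩
      c * 1                                            ≡⟨ *-identityʳ c ⟩
      c                                                ∎
  ... | inj₂ outside = begin
      f b + c * count b (span ρ)  ≡⟨ cong₂ (λ u v → u + c * v) (off-span b outside) (count-span-outside ρ b outside) ⟩
      c + c * 0                   ≡⟨ cong (c +_) (*-zeroʳ c) ⟩
      c + 0                       ≡⟨ +-identityʳ c ⟩
      c                           ∎

-- The block counts.  Throughout, n = 2^m and X = F_{2^m} ∖ {0,1}; the
-- hypothesis 1 ≠ 0 (that is, m ≥ 1) makes {0, 1} a 2-element span.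
module Blocks (m : ℕ) (1≢0 : ¬ 1F m ≡ 0F m) where

  open DecMembership (_≟F_ {m}) using (_∈?_)

  E : List (F m)
  E = elements m

  n : ℕ
  n = 2 ^ m

  InX : F m → Set
  InX z = ¬ z ≡ 0F m × ¬ z ≡ 1F m

  inX? : (z : F m) → Dec (InX z)
  inX? z = ¬? (z ≟F 0F m) ×-dec ¬? (z ≟F 1F m)

  count-X : ∀ x → count x (X m) ≡ χ (inX? x)
  count-X x = trans (count-filter inX? x E) (trans (cong (χ (inX? x) *_) (count-elements m x)) (*-identityʳ _))

  distinct-X : Distinct (X m)
  distinct-X = distinct-filter inX? E (distinct-elements m)

  isOne : F m → ℕ
  isOne v = χ (v ≟F 1F m)

  differ : F m → F m → ℕ
  differ u v = χ (¬? (u ≟F v))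

  r : F m → ℕ
  r x = ∑ (combinations 3 (remove x (X m))) (λ R → isOne (x +F sumF m R))

  pointed-sum : ∀ (g h : F m → ℕ) B → pointed (λ y R → g (y +F sumF m R) * h y) B ≡ g (sumF m B) * ∑ B h
  pointed-sum g h [] = sym (*-zeroʳ (g (0F m)))
  pointed-sum g h (x ∷ B) = begin
      g (x +F ΣB) * h x + pointed (λ y R → g (y +F (x +F sumF m R)) * h y) B
    ≡⟨ cong (g (x +F ΣB) * h x +_) (pointed-cong (λ y R → cong (λ v → g v * h y) (+F-swap y x (sumF m R))) B) ⟩
      g (x +F ΣB) * h x + pointed (λ y R → g (x +F (y +F sumF m R)) * h y) B
    ≡⟨ cong (g (x +F ΣB) * h x +_) (pointed-sum (λ v → g (x +F v)) h B) ⟩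
      g (x +F ΣB) * h x + g (x +F ΣB) * ∑ B h
    ≡⟨ sym (*-distribˡ-+ (g (x +F ΣB)) (h x) _) ⟩
      g (x +F ΣB) * (h x + ∑ B h)
    ∎
    where
    open ≡-Reasoning
    ΣB = sumF m B
    +F-swap : ∀ u v w → u +F (v +F w) ≡ v +F (u +F w)
    +F-swap u v w = solve (v₀ ⊕ v₁ ⊕ v₂) (v₁ ⊕ v₀ ⊕ v₂) refl (u ∷ v ∷ w ∷ [])

  ∑-combinations-pointed : ∀ (g : F m → ℕ) k L →
    ∑ (combinations k L) (λ R → g (sumF m R)) * k ≡ ∑ (combinations k L) (pointed (λ y R → g (y +F sumF m R)))
  ∑-combinations-pointed g k L =
    trans (sym (∑-*ʳ (combinations k L) k _)) (∑-congᴬ (All.map (λ {B} → size-k {B}) (combinations-inside k L)))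
    where
    size-k : ∀ {B} → length B ≡ k × (∀ t → count t B ≤ count t L) → g (sumF m B) * k ≡ pointed (λ y R → g (y +F sumF m R)) B
    size-k {B} (len , _) = begin
        g (sumF m B) * k
      ≡⟨ cong (g (sumF m B) *_) (sym (trans (∑-const B 1) (trans (*-identityʳ _) len))) ⟩
        g (sumF m B) * ∑ B (λ _ → 1)
      ≡⟨ sym (pointed-sum g (λ _ → 1) B) ⟩
        pointed (λ y R → g (y +F sumF m R) * 1) B
      ≡⟨ pointed-cong (λ y R → *-identityʳ _) B ⟩
        pointed (λ y R → g (y +F sumF m R)) B
      ∎
      where open ≡-Reasoning

  rep4≡r : ∀ x → InX x → rep4 m x ≡ r x
  rep4≡r x x∈X = begin
      rep4 m x
    ≡⟨ length-filter (x ∈?_) (W4 m) ⟩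
      ∑ (W4 m) (λ B → χ (x ∈? B))
    ≡⟨ ∑-filter (λ B → sumF m B ≟F 1F m) C₄ _ ⟩
      ∑ C₄ (λ B → isOne (sumF m B) * χ (x ∈? B))
    ≡⟨ ∑-congᴬ (All.map (λ {B} → point-at-x {B}) (combinations-distinct 4 (X m) distinct-X)) ⟩
      ∑ C₄ (pointed (λ y R → isOne (y +F sumF m R) * χ (x ≟F y)))
    ≡⟨ ∑-pointed-combinations (X m) distinct-X 3 _ ⟩
      ∑ (X m) (λ y → ∑ (combinations 3 (remove y (X m))) (λ R → isOne (y +F sumF m R) * χ (x ≟F y)))
    ≡⟨ ∑-cong (X m) (λ y → ∑-*ʳ (combinations 3 (remove y (X m))) (χ (x ≟F y)) _) ⟩
      ∑ (X m) (λ y → r y * χ (x ≟F y))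
    ≡⟨ ∑-select x (X m) r ⟩
      r x * count x (X m)
    ≡⟨ cong (r x *_) (trans (count-X x) (χ-yes x∈X (inX? x))) ⟩
      r x * 1
    ≡⟨ *-identityʳ (r x) ⟩
      r x
    ∎
    where
    open ≡-Reasoning
    C₄ = combinations 4 (X m)
    point-at-x : ∀ {B} → Distinct B → isOne (sumF m B) * χ (x ∈? B) ≡ pointed (λ y R → isOne (y +F sumF m R) * χ (x ≟F y)) B
    point-at-x {B} d = trans (cong (isOne (sumF m B) *_) (χ-∈≡count x B d)) (sym (pointed-sum isOne (λ y → χ (x ≟F y)) B))

  4|W4|≡∑r : length (W4 m) * 4 ≡ ∑ (X m) r
  4|W4|≡∑r = begin
      length (W4 m) * 4
    ≡⟨ cong (_* 4) (length-filter (λ B → sumF m B ≟F 1F m) (combinations 4 (X m))) ⟩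
      ∑ (combinations 4 (X m)) (λ B → isOne (sumF m B)) * 4
    ≡⟨ ∑-combinations-pointed isOne 4 (X m) ⟩
      ∑ (combinations 4 (X m)) (pointed (λ y R → isOne (y +F sumF m R)))
    ≡⟨ ∑-pointed-combinations (X m) distinct-X 3 _ ⟩
      ∑ (X m) r
    ∎
    where open ≡-Reasoning

  -- The element completing x, a, b to four elements with sum 1.
  fourth : F m → F m → F m → F m
  fourth x a b = (x +F a) +F (b +F 1F m)

  Completes : F m → F m → F m → Set
  Completes x a b =
    let t = fourth x a b in InX b × ¬ x ≡ b × ¬ a ≡ b × ¬ b ≡ t × ¬ a ≡ t × ¬ x ≡ t × InX t

  completes? : ∀ x a b → Dec (Completes x a b)
  completes? x a b = let t = fourth x a b in
    inX? b ×-dec ¬? (x ≟F b) ×-dec ¬? (a ≟F b) ×-dec ¬? (b ≟F t) ×-dec ¬? (a ≟F t) ×-dec ¬? (x ≟F t) ×-dec inX? t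

  χ-completes : ∀ x a b → let t = fourth x a b in χ (completes? x a b)
    ≡ χ (inX? b) * (differ x b * (differ a b * (differ b t * (differ a t * (differ x t * χ (inX? t))))))
  χ-completes x a b =
    trans (χ-× (inX? b) d₁) (cong (χ (inX? b) *_)
    (trans (χ-× (¬? (x ≟F b)) d₂) (cong (differ x b *_)
    (trans (χ-× (¬? (a ≟F b)) d₃) (cong (differ a b *_)
    (trans (χ-× (¬? (b ≟F t)) d₄) (cong (differ b t *_)
    (trans (χ-× (¬? (a ≟F t)) d₅) (cong (differ a t *_)
    (χ-× (¬? (x ≟F t)) (inX? t)))))))))))
    where
    t = fourth x a b
    d₅ = ¬? (x ≟F t) ×-dec inX? t
    d₄ = ¬? (a ≟F t) ×-dec d₅
    d₃ = ¬? (b ≟F t) ×-dec d₄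
    d₂ = ¬? (a ≟F b) ×-dec d₃
    d₁ = ¬? (x ≟F b) ×-dec d₂

  s : F m → F m → ℕ
  s x a = ∑ E (λ b → χ (completes? x a b))

  -- 3 r x: single out one of the three elements added to x, call it a.
  3r≡ : ∀ x → r x * 3 ≡ ∑ (remove x (X m)) (λ a →
                          ∑ (combinations 2 (remove a (remove x (X m)))) (λ R → isOne (x +F (a +F sumF m R))))
  3r≡ x = trans (∑-combinations-pointed (λ v → isOne (x +F v)) 3 Y) (∑-pointed-combinations Y (distinct-filter _ (X m) distinct-X) 2 _)
    where Y = remove x (X m)

  -- 2 × (pairs {b, c} ⊆ X ∖ {x, a} with x + a + b + c = 1) = s x a: once b is
  -- singled out, c = fourth x a b is forced.
  2·pairs≡s : ∀ x a → ∑ (combinations 2 (remove a (remove x (X m)))) (λ R → isOne (x +F (a +F sumF m R))) * 2 ≡ s x a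
  2·pairs≡s x a = begin
      ∑ (combinations 2 Z) (λ R → g (sumF m R)) * 2
    ≡⟨ ∑-combinations-pointed g 2 Z ⟩
      ∑ (combinations 2 Z) (pointed (λ y R → g (y +F sumF m R)))
    ≡⟨ ∑-pointed-combinations Z distinct-Z 1 _ ⟩
      ∑ Z (λ b → ∑ (combinations 1 (remove b Z)) (λ R → g (b +F sumF m R)))
    ≡⟨ ∑-cong Z (λ b → trans (∑-singletons (remove b Z) _) (∑-cong (remove b Z) (forced b))) ⟩
      ∑ Z (λ b → count (fourth x a b) (remove b Z))
    ≡⟨ ∑-cong Z count-fourth ⟩
      ∑ Z (λ b → let t = fourth x a b in differ b t * (differ a t * (differ x t * χ (inX? t))))
    ≡⟨ trans (∑-filter _ (remove x (X m)) _) (trans (∑-filter _ (X m) _) (∑-filter inX? E _)) ⟩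
      ∑ E (λ b → let t = fourth x a b in
                 χ (inX? b) * (differ x b * (differ a b * (differ b t * (differ a t * (differ x t * χ (inX? t)))))))
    ≡⟨ sym (∑-cong E (χ-completes x a)) ⟩
      s x a
    ∎
    where
    open ≡-Reasoning
    Z = remove a (remove x (X m))
    g : F m → ℕ
    g v = isOne (x +F (a +F v))
    distinct-Z : Distinct Z
    distinct-Z = distinct-filter _ (remove x (X m)) (distinct-filter _ (X m) distinct-X)
    forced : ∀ b c → g (b +F (c +F 0F m)) ≡ χ (fourth x a b ≟F c)
    forced b c = χ-⇔
      (+F-transfer (solve (lhs ⊕ v₄) (((v₀ ⊕ v₁) ⊕ (v₂ ⊕ v₄)) ⊕ v₃) refl ρ))
      (+F-transfer (solve (((v₀ ⊕ v₁) ⊕ (v₂ ⊕ v₄)) ⊕ v₃) (lhs ⊕ v₄) refl ρ))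
      ((x +F (a +F (b +F (c +F 0F m)))) ≟F 1F m) (fourth x a b ≟F c)
      where
      lhs = v₀ ⊕ v₁ ⊕ v₂ ⊕ v₃ ⊕ 𝟎
      ρ = x ∷ a ∷ b ∷ c ∷ 1F m ∷ []
    count-fourth : ∀ b → let t = fourth x a b in count t (remove b Z) ≡ differ b t * (differ a t * (differ x t * χ (inX? t)))
    count-fourth b =
      trans (count-remove b t Z) (cong (differ b t *_)
      (trans (count-remove a t (remove x (X m))) (cong (differ a t *_)
      (trans (count-remove x t (X m)) (cong (differ x t *_) (count-X t))))))
      where t = fourth x a b

  6r≡∑s : ∀ x → r x * 6 ≡ ∑ E (λ a → χ (inX? a) * (differ x a * s x a))
  6r≡∑s x = begin
      r x * 6
    ≡⟨ sym (*-assoc (r x) 3 2) ⟩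
      r x * 3 * 2
    ≡⟨ cong (_* 2) (3r≡ x) ⟩
      ∑ Y (λ a → ∑ (combinations 2 (remove a Y)) (λ R → isOne (x +F (a +F sumF m R)))) * 2
    ≡⟨ sym (∑-*ʳ Y 2 _) ⟩
      ∑ Y (λ a → ∑ (combinations 2 (remove a Y)) (λ R → isOne (x +F (a +F sumF m R))) * 2)
    ≡⟨ ∑-cong Y (2·pairs≡s x) ⟩
      ∑ Y (s x)
    ≡⟨ trans (∑-filter _ (X m) _) (∑-filter inX? E _) ⟩
      ∑ E (λ a → χ (inX? a) * (differ x a * s x a))
    ∎
    where
    open ≡-Reasoning
    Y = remove x (X m)

  InX⇒∉span1 : ∀ {z} → InX z → ∀ w → ¬ z ≡ combo w (1F m ∷ [])
  InX⇒∉span1 {z} (z≢0 , z≢1) (false ∷ []) e = z≢0 (trans e (+F-identityˡ (0F m)))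
  InX⇒∉span1 {z} (z≢0 , z≢1) (true ∷ []) e = z≢1 (trans e (solve (v₀ ⊕ 𝟎) v₀ refl (1F m ∷ [])))

  ∉span1⇒InX : ∀ {z} → (∀ w → ¬ z ≡ combo w (1F m ∷ [])) → InX z
  ∉span1⇒InX z∉ = (λ e → z∉ (false ∷ []) (trans e (sym (+F-identityˡ (0F m)))))
                 , (λ e → z∉ (true ∷ []) (trans e (solve v₀ (v₀ ⊕ 𝟎) refl (1F m ∷ []))))

  independent-1 : Independent (1F m ∷ [])
  independent-1 = independent-∷ (1F m) [] independent-[] (λ { [] → 1≢0 })

  independent-x1 : ∀ x → InX x → Independent (x ∷ 1F m ∷ [])
  independent-x1 x x∈X = independent-∷ x (1F m ∷ []) independent-1 (InX⇒∉span1 x∈X)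

  -- For a ∉ span{x, 1}, b completes (x, a) exactly when b avoids the span of
  -- a, x, 1.  Elements are written as terms in a, x, 1 (and b as a fourth
  -- variable) so that the case distinctions are settled by `solve`.
  module Completion (x a : F m) where

    ρ : Vec (F m) 3
    ρ = a ∷ x ∷ 1F m ∷ []

    b̂ : ∀ {k} → Vec Bool 3 → Term (3 + k)
    b̂ w = comboᵗ w (v₀ ∷ v₁ ∷ v₂ ∷ [])

    t̂ : ∀ {k} → Vec Bool 3 → Term (3 + k)
    t̂ w = (v₁ ⊕ v₀) ⊕ (b̂ w ⊕ v₂)

    in-span-fails : ∀ w → ¬ Completes x a (combo w ρ)
    in-span-fails w@(false ∷ false ∷ false ∷ []) ((b≢0 , _) , _) = b≢0 (solve (b̂ w) 𝟎 refl ρ)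
    in-span-fails w@(false ∷ false ∷ true ∷ []) ((_ , b≢1) , _) = b≢1 (solve (b̂ w) v₂ refl ρ)
    in-span-fails w@(false ∷ true ∷ false ∷ []) (_ , x≢b , _) = x≢b (solve v₁ (b̂ w) refl ρ)
    in-span-fails w@(true ∷ false ∷ false ∷ []) (_ , _ , a≢b , _) = a≢b (solve v₀ (b̂ w) refl ρ)
    in-span-fails w@(true ∷ true ∷ true ∷ []) (_ , _ , _ , _ , _ , _ , (t≢0 , _)) = t≢0 (solve (t̂ w) 𝟎 refl ρ)
    in-span-fails w@(true ∷ true ∷ false ∷ []) (_ , _ , _ , _ , _ , _ , (_ , t≢1)) = t≢1 (solve (t̂ w) v₂ refl ρ)
    in-span-fails w@(true ∷ false ∷ true ∷ []) (_ , _ , _ , _ , _ , x≢t , _) = x≢t (solve v₁ (t̂ w) refl ρ)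
    in-span-fails w@(false ∷ true ∷ true ∷ []) (_ , _ , _ , _ , a≢t , _) = a≢t (solve v₀ (t̂ w) refl ρ)

    -- Each condition fails only on the span (b ≠ fourth x a b fails only if
    -- a = x + 1, which is excluded by a ∉ span{x, 1}).
    off-span-completes : (∀ w → ¬ a ≡ combo w (x ∷ 1F m ∷ [])) → ∀ b → (∀ w → ¬ b ≡ combo w ρ) → Completes x a b
    off-span-completes a∉span b b∉span =
        ( (λ e → b∉span w₀₀₀ (trans e (solve 𝟎 (b̂ w₀₀₀) refl ρ)))
        , (λ e → b∉span w₀₀₁ (trans e (solve v₂ (b̂ w₀₀₁) refl ρ))) )
      , (λ e → b∉span w₀₁₀ (trans (sym e) (solve v₁ (b̂ w₀₁₀) refl ρ)))
      , (λ e → b∉span w₁₀₀ (trans (sym e) (solve v₀ (b̂ w₁₀₀) refl ρ)))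
      , (λ e → a∉span (true ∷ true ∷ []) (+F-transfer (solve (v₃ ⊕ t) (v₀ ⊕ v₁ ⊕ v₂ ⊕ 𝟎) refl ρ₄) e))
      , (λ e → b∉span w₀₁₁ (+F-transfer (solve (v₀ ⊕ t) (v₃ ⊕ b̂ w₀₁₁) refl ρ₄) e))
      , (λ e → b∉span w₁₀₁ (+F-transfer (solve (v₁ ⊕ t) (v₃ ⊕ b̂ w₁₀₁) refl ρ₄) e))
      , ( (λ e → b∉span w₁₁₁ (+F-transfer (solve (t ⊕ 𝟎) (v₃ ⊕ b̂ w₁₁₁) refl ρ₄) e))
        , (λ e → b∉span w₁₁₀ (+F-transfer (solve (t ⊕ v₂) (v₃ ⊕ b̂ w₁₁₀) refl ρ₄) e)) )
      where
      ρ₄ = a ∷ x ∷ 1F m ∷ b ∷ []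
      t : Term 4
      t = (v₁ ⊕ v₀) ⊕ (v₃ ⊕ v₂)
      w₀₀₀ = false ∷ false ∷ false ∷ []
      w₀₀₁ = false ∷ false ∷ true ∷ []
      w₀₁₀ = false ∷ true ∷ false ∷ []
      w₁₀₀ = true ∷ false ∷ false ∷ []
      w₀₁₁ = false ∷ true ∷ true ∷ []
      w₁₀₁ = true ∷ false ∷ true ∷ []
      w₁₁₀ = true ∷ true ∷ false ∷ []
      w₁₁₁ = true ∷ true ∷ true ∷ []

  -- Hence, for a ∉ span{x, 1}, s x a = n - |span{a, x, 1}| = n - 8.
  s-generic : ∀ x a → InX x → (∀ w → ¬ a ≡ combo w (x ∷ 1F m ∷ [])) → s x a ≡ n ∸ 8
  s-generic x a x∈X a∉span = +-to-∸ (∑-off-span ρ independent (λ b → χ (completes? x a b)) 1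
      (λ w → χ-no (in-span-fails w) (completes? x a (combo w ρ)))
      (λ b b∉span → χ-yes (off-span-completes a∉span b b∉span) (completes? x a b)))
    where
    open Completion x a
    independent : Independent ρ
    independent = independent-∷ a _ (independent-x1 x x∈X) a∉span
    +-to-∸ : ∀ {u} → u + 1 * 8 ≡ 1 * n → u ≡ n ∸ 8
    +-to-∸ {u} e = trans (sym (m+n∸n≡m u 8)) (cong (_∸ 8) (trans (cong (u +_) (sym (*-identityˡ 8))) (trans e (*-identityˡ n))))

  -- For a = x + 1 the would-be fourth element is b itself, so s x a = 0.
  s-degenerate : ∀ x → s x (combo (true ∷ true ∷ []) (x ∷ 1F m ∷ [])) ≡ 0
  s-degenerate x = ∑-zero E _ (λ b → χ-no (λ { (_ , _ , _ , b≢t , _) → b≢t (sym (fourth≡b b)) }) (completes? x a b))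
    where
    a = combo (true ∷ true ∷ []) (x ∷ 1F m ∷ [])
    fourth≡b : ∀ b → fourth x a b ≡ b
    fourth≡b b = solve ((v₀ ⊕ (v₀ ⊕ v₂ ⊕ 𝟎)) ⊕ (v₁ ⊕ v₂)) v₁ refl (x ∷ b ∷ 1F m ∷ [])

  -- The weight of the first element a in 6 r x (see 6r≡∑s), for fixed x ∈ X:
  -- it vanishes on span{x, 1} and equals n - 8 off it.
  module FirstElement (x : F m) (x∈X : InX x) where

    ρ : Vec (F m) 2
    ρ = x ∷ 1F m ∷ []

    weight : F m → ℕ
    weight a = χ (inX? a) * (differ x a * s x a)

    weight-∉X : ∀ {a} → ¬ InX a → weight a ≡ 0
    weight-∉X {a} a∉X = cong (_* (differ x a * s x a)) (χ-no a∉X (inX? a))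

    weight-x : ∀ {a} → x ≡ a → weight a ≡ 0
    weight-x {a} x≡a =
      trans (cong (λ u → χ (inX? a) * (u * s x a)) (χ-no (λ x≢a → x≢a x≡a) (¬? (x ≟F a)))) (*-zeroʳ (χ (inX? a)))

    -- a = 0 and a = 1 are not in X, a = x is excluded, and a = x + 1 has no
    -- completions.
    weight-in-span : ∀ w → weight (combo w ρ) ≡ 0
    weight-in-span w@(false ∷ false ∷ []) = weight-∉X (λ { (a≢0 , _) → a≢0 (solve (comboᵗ w (v₀ ∷ v₁ ∷ [])) 𝟎 refl ρ) })
    weight-in-span w@(false ∷ true ∷ []) = weight-∉X (λ { (_ , a≢1) → a≢1 (solve (comboᵗ w (v₀ ∷ v₁ ∷ [])) v₁ refl ρ) })
    weight-in-span w@(true ∷ false ∷ []) = weight-x (solve v₀ (comboᵗ w (v₀ ∷ v₁ ∷ [])) refl ρ)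
    weight-in-span w@(true ∷ true ∷ []) =
      trans (cong (λ u → χ (inX? a) * (differ x a * u)) (s-degenerate x))
            (trans (cong (χ (inX? a) *_) (*-zeroʳ (differ x a))) (*-zeroʳ (χ (inX? a))))
      where a = combo w ρ

    weight-off-span : ∀ a → (∀ w → ¬ a ≡ combo w ρ) → weight a ≡ n ∸ 8
    weight-off-span a a∉span = begin
        χ (inX? a) * (differ x a * s x a)
      ≡⟨ cong₂ (λ u v → u * (v * s x a)) (χ-yes a∈X (inX? a)) (χ-yes x≢a (¬? (x ≟F a))) ⟩
        1 * (1 * s x a)
      ≡⟨ trans (*-identityˡ _) (*-identityˡ _) ⟩
        s x a
      ≡⟨ s-generic x a x∈X a∉span ⟩
        n ∸ 8
      ∎
      where
      open ≡-Reasoning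
      a∈X : InX a
      a∈X = ( (λ e → a∉span (false ∷ false ∷ []) (trans e (solve 𝟎 (𝟎 ⊕ 𝟎 ⊕ 𝟎) refl ρ)))
            , (λ e → a∉span (false ∷ true ∷ []) (trans e (solve v₁ (𝟎 ⊕ v₁ ⊕ 𝟎) refl ρ))) )
      x≢a : ¬ x ≡ a
      x≢a e = a∉span (true ∷ false ∷ []) (trans (sym e) (solve v₀ (v₀ ⊕ 𝟎 ⊕ 𝟎) refl ρ))

  -- 6 r x = (n - 4)(n - 8): the first element a ranges over the n - 4 elements
  -- outside span{x, 1}, each contributing s x a = n - 8.
  6r≡ : ∀ x → InX x → r x * 6 ≡ (n ∸ 4) * (n ∸ 8)
  6r≡ x x∈X = begin
      r x * 6
    ≡⟨ 6r≡∑s x ⟩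
      ∑ E weight
    ≡⟨ sym (m+n∸n≡m (∑ E weight) ((n ∸ 8) * 4)) ⟩
      ∑ E weight + (n ∸ 8) * 4 ∸ (n ∸ 8) * 4
    ≡⟨ cong (_∸ (n ∸ 8) * 4) (∑-off-span ρ (independent-x1 x x∈X) weight (n ∸ 8) weight-in-span weight-off-span) ⟩
      (n ∸ 8) * n ∸ (n ∸ 8) * 4
    ≡⟨ sym (*-distribˡ-∸ (n ∸ 8) n 4) ⟩
      (n ∸ 8) * (n ∸ 4)
    ≡⟨ *-comm (n ∸ 8) (n ∸ 4) ⟩
      (n ∸ 4) * (n ∸ 8)
    ∎
    where
    open ≡-Reasoning
    open FirstElement x x∈X

  length-X : length (X m) ≡ n ∸ 2
  length-X = trans (sym (m+n∸n≡m (length (X m)) 2)) (cong (_∸ 2) (begin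
      length (X m) + 2
    ≡⟨ cong (_+ 2) (length-filter inX? E) ⟩
      ∑ E (λ z → χ (inX? z)) + 1 * 2
    ≡⟨ ∑-off-span (1F m ∷ []) independent-1 (λ z → χ (inX? z)) 1
                  (λ w → χ-no (λ z∈X → InX⇒∉span1 z∈X w refl) (inX? (combo w (1F m ∷ []))))
                  (λ z z∉span → χ-yes (∉span1⇒InX z∉span) (inX? z)) ⟩
      1 * n
    ≡⟨ *-identityˡ n ⟩
      n
    ∎))
    where open ≡-Reasoning

  24|W4|≡ : length (W4 m) * 24 ≡ (n ∸ 2) * (n ∸ 4) * (n ∸ 8)
  24|W4|≡ = begin
      length (W4 m) * 24
    ≡⟨ sym (*-assoc (length (W4 m)) 4 6) ⟩
      length (W4 m) * 4 * 6
    ≡⟨ cong (_* 6) 4|W4|≡∑r ⟩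
      ∑ (X m) r * 6
    ≡⟨ sym (∑-*ʳ (X m) 6 r) ⟩
      ∑ (X m) (λ x → r x * 6)
    ≡⟨ ∑-congᴬ (All.map (λ {x} → 6r≡ x) (all-filter inX? E)) ⟩
      ∑ (X m) (λ _ → (n ∸ 4) * (n ∸ 8))
    ≡⟨ ∑-const (X m) _ ⟩
      length (X m) * ((n ∸ 4) * (n ∸ 8))
    ≡⟨ cong (_* ((n ∸ 4) * (n ∸ 8))) length-X ⟩
      (n ∸ 2) * ((n ∸ 4) * (n ∸ 8))
    ≡⟨ sym (*-assoc (n ∸ 2) (n ∸ 4) (n ∸ 8)) ⟩
      (n ∸ 2) * (n ∸ 4) * (n ∸ 8)
    ∎
    where open ≡-Reasoning

1F≢0F : ∀ m → 1 ≤ m → ¬ 1F m ≡ 0F m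
1F≢0F (suc m) _ ()

corollary3p14 : (m : ℕ) → 4 ≤ m →
    ((x : F m) → x ≢ 0F m → x ≢ 1F m →
      rep4 m x * 6 ≡ (2 ^ m ∸ 4) * (2 ^ m ∸ 8))
    × (length (W4 m) * 24 ≡ (2 ^ m ∸ 2) * (2 ^ m ∸ 4) * (2 ^ m ∸ 8))
corollary3p14 m 4≤m = repetition , 24|W4|≡
  where
  open Blocks m (1F≢0F m (≤-trans (s≤s z≤n) 4≤m))
  repetition : (x : F m) → x ≢ 0F m → x ≢ 1F m → rep4 m x * 6 ≡ (n ∸ 4) * (n ∸ 8)
  repetition x x≢0 x≢1 = trans (cong (_* 6) (rep4≡r x (x≢0 , x≢1))) (6r≡ x (x≢0 , x≢1))
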